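{- For any instance of CSPDP with demand pair set $P$ in an undirected weighted graph $G$ with $n$ vertices and $m$ edges, one can construct an instance of CSPDP with the same pair set $P$ (each pair given an orientation) in a directed weighted graph $R$ with $n+2m$ vertices and $5m$ edges (with nonnegative weights) such that both instances have the same objective value.
   Context: CSPDP: the input is a graph $G=(V,E)$, directed or undirected, with nonnegative edge weights $c$ which also serve as edge lengths, and a set $P$ of demand pairs of vertices (ordered pairs in the directed case). For a subgraph $H$, $dist_H(u,w)$ is the shortest-path distance in $H$ with respect to $c$, and $c(H)=\sum_{e\in E(H)}c(e)$. $H$ is a distance preserver for $P$ if $dist_H(u,w)=dist_G(u,w)$ for all $(u,w)\in P$. With $U=\sum_{(u,w)\in P}dist_G(u,w)$, CSPDP asks for a distance preserver $H$ maximizing $U-c(H)$; the objective value of an instance is this maximum.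
   Formalization: The edge weights of G and R are nonnegative rationals rather than nonnegative reals. -}

module Defs where

open import Data.Nat using (ℕ; zero; suc)
open import Data.Fin using (Fin; zero; suc)
open import Data.Bool using (Bool; true; false; if_then_else_)
open import Data.Product using (Σ; _×_; _,_; proj₁; proj₂)
open import Data.Sum using (_⊎_)
open import Data.List using (List; []; _∷_)
open import Data.List.Relation.Unary.All using (All)
open import Data.Rational using (ℚ; 0ℚ; _≤_; _+_; _-_)
open import Relation.Binary.PropositionalEquality using (_≡_; _≢_)

-- Whether the graph is read as directed
-- or undirected is decided by the step relation used (dirStep / undStep).
record WGraph (n m : ℕ) : Set where
  field
    endpoints : Fin m → Fin n × Fin n
    weight    : Fin m → ℚ
open WGraph public

NonNegWeights : ∀ {n m} → WGraph n m → Set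
NonNegWeights {m = m} G = (e : Fin m) → 0ℚ ≤ weight G e

UndSimple : ∀ {n m} → WGraph n m → Set
UndSimple {m = m} G =
  ((e : Fin m) → proj₁ (endpoints G e) ≢ proj₂ (endpoints G e)) ×
  ((e e′ : Fin m) →
     (endpoints G e ≡ endpoints G e′ ⊎
      endpoints G e ≡ (proj₂ (endpoints G e′) , proj₁ (endpoints G e′))) →
     e ≡ e′)

DirSimple : ∀ {n m} → WGraph n m → Set
DirSimple {m = m} G =
  ((e : Fin m) → proj₁ (endpoints G e) ≢ proj₂ (endpoints G e)) ×
  ((e e′ : Fin m) → endpoints G e ≡ endpoints G e′ → e ≡ e′)

-- a (spanning) subgraph is given by the set of edges it keeps
Subgraph : ℕ → Set
Subgraph m = Fin m → Bool

full : ∀ {m} → Subgraph m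
full _ = true

sumFin : (m : ℕ) → (Fin m → ℚ) → ℚ
sumFin zero    f = 0ℚ
sumFin (suc m) f = f zero + sumFin m (λ i → f (suc i))

cost : ∀ {n m} → WGraph n m → Subgraph m → ℚ
cost {m = m} G H = sumFin m (λ e → if H e then weight G e else 0ℚ)

StepRel : ℕ → Set₁
StepRel n = Fin n → Fin n → ℚ → Set

dirStep : ∀ {n m} → WGraph n m → Subgraph m → StepRel n
dirStep {m = m} G H u v c =
  Σ (Fin m) λ e → H e ≡ true × endpoints G e ≡ (u , v) × weight G e ≡ c

undStep : ∀ {n m} → WGraph n m → Subgraph m → StepRel n
undStep {m = m} G H u v c =
  Σ (Fin m) λ e → H e ≡ true ×
    (endpoints G e ≡ (u , v) ⊎ endpoints G e ≡ (v , u)) × weight G e ≡ c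

data Walk {n : ℕ} (S : StepRel n) : Fin n → Fin n → ℚ → Set where
  here : ∀ {v} → Walk S v v 0ℚ
  step : ∀ {u v w c d} → S u v c → Walk S v w d → Walk S u w (c + d)

-- d is the shortest-path distance from u to w (exists only when w is reachable)
IsDist : ∀ {n} → StepRel n → Fin n → Fin n → ℚ → Set
IsDist S u w d = Walk S u w d × ((d′ : ℚ) → Walk S u w d′ → d ≤ d′)

TotalDist : ∀ {n} → StepRel n → List (Fin n × Fin n) → ℚ → Set
TotalDist S []             U = U ≡ 0ℚ
TotalDist S ((u , w) ∷ P)  U =
  Σ ℚ λ d → Σ ℚ λ U′ → IsDist S u w d × TotalDist S P U′ × U ≡ d + U′

Reading : ℕ → ℕ → Set₁
Reading n m = Subgraph m → StepRel n

-- H is a distance preserver for P: dist_H(u,w) = dist_G(u,w) for all pairs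
-- (if w is unreachable from u in G it is also unreachable in H ⊆ G)
Preserver : ∀ {n m} → Reading n m → List (Fin n × Fin n) → Subgraph m → Set
Preserver st P H =
  All (λ p → (d : ℚ) → IsDist (st full) (proj₁ p) (proj₂ p) d →
                       IsDist (st H) (proj₁ p) (proj₂ p) d) P

ObjVal : ∀ {n m} → WGraph n m → Reading n m → List (Fin n × Fin n) → ℚ → Set
ObjVal {m = m} G st P v =
  Σ ℚ λ U → TotalDist (st full) P U ×
    (Σ (Subgraph m) λ H → Preserver st P H × U - cost G H ≡ v) ×
    ((H : Subgraph m) → Preserver st P H → U - cost G H ≤ v)

UndObjVal : ∀ {n m} → WGraph n m → List (Fin n × Fin n) → ℚ → Set
UndObjVal G P v = ObjVal G (undStep G) P v

DirObjVal : ∀ {n m} → WGraph n m → List (Fin n × Fin n) → ℚ → Set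
DirObjVal G P v = ObjVal G (dirStep G) P v

OrientedAs : ∀ {n n′} → (Fin n → Fin n′) → Fin n × Fin n → Fin n′ × Fin n′ → Set
OrientedAs ι (u , w) q = q ≡ (ι u , ι w) ⊎ q ≡ (ι w , ι u)

module Submission where

-- Every undirected edge e = {p, q} of G with weight c(e) is replaced by a gadget
-- with two fresh vertices a_e (entry) and b_e (exit) and five arcs
--     p → a_e, q → a_e   (weight 0),   a_e → b_e  (weight c(e)),   b_e → p, b_e → q   (weight 0),
-- giving a directed graph R with n + 2m vertices and 5m arcs.  A subgraph H of G is
-- lifted to R by keeping all five arcs of every kept edge; a subgraph H′ of R is
-- projected to G by keeping e iff the middle arc a_e → b_e is kept.  Both maps
-- preserve the cost, lifting copies walks of G into R with the same length, and
-- every R-walk between original vertices shortcuts to a G-walk in the projection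
-- that is no longer (a detour through a gadget back to its starting end is a loop
-- of nonnegative length).

open import Defs
open import Data.Nat using (ℕ; zero; suc; _+_; _*_)
open import Data.Fin using (Fin; zero; suc; _↑ˡ_; _↑ʳ_; splitAt; combine; remQuot)
open import Data.Fin.Patterns using (0F; 1F; 2F; 3F; 4F)
open import Data.Fin.Properties using (splitAt-↑ˡ; splitAt-↑ʳ; remQuot-combine; combine-remQuot)
open import Data.Product using (Σ; _×_; _,_; proj₁; proj₂; uncurry)
import Data.Product as Product
open import Data.Sum using (_⊎_; inj₁; inj₂; [_,_]′)
open import Data.List using (List; []; _∷_; map)
open import Data.List.Relation.Binary.Pointwise using (Pointwise; []; _∷_)
import Data.List.Relation.Unary.All as All
open import Data.List.Relation.Unary.All.Properties using (map⁺; map⁻)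
open import Data.Bool using (true; false; if_then_else_)
open import Data.Empty using (⊥-elim)
open import Data.Rational as ℚ using (ℚ; 0ℚ)
import Data.Rational.Properties as ℚₚ
open import Function using (_∘_)
open import Function.Definitions using (Injective)
open import Function.Bundles using (_⇔_; mk⇔)
open import Relation.Binary.PropositionalEquality

private
  variable
    n n′ n₁ n₂ n₃ m m′ : ℕ

sumFin-cong : ∀ k {f g : Fin k → ℚ} → (∀ i → f i ≡ g i) → sumFin k f ≡ sumFin k g
sumFin-cong zero    f≗g = refl
sumFin-cong (suc k) f≗g = cong₂ ℚ._+_ (f≗g zero) (sumFin-cong k (f≗g ∘ suc))

sumFin-zero : ∀ k {f : Fin k → ℚ} → (∀ i → f i ≡ 0ℚ) → sumFin k f ≡ 0ℚ
sumFin-zero zero    f≗0 = refl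
sumFin-zero (suc k) f≗0 =
  trans (cong₂ ℚ._+_ (f≗0 zero) (sumFin-zero k (f≗0 ∘ suc))) (ℚₚ.+-identityˡ 0ℚ)

sumFin-++ : ∀ a b (f : Fin (a + b) → ℚ) →
            sumFin (a + b) f ≡ sumFin a (λ i → f (i ↑ˡ b)) ℚ.+ sumFin b (λ j → f (a ↑ʳ j))
sumFin-++ zero    b f = sym (ℚₚ.+-identityˡ _)
sumFin-++ (suc a) b f =
  trans (cong (f zero ℚ.+_) (sumFin-++ a b (f ∘ suc))) (sym (ℚₚ.+-assoc (f zero) _ _))

sumFin-combine : ∀ k m (f : Fin (k * m) → ℚ) →
                 sumFin (k * m) f ≡ sumFin k (λ i → sumFin m (λ j → f (combine i j)))
sumFin-combine zero    m f = refl
sumFin-combine (suc k) m f =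
  trans (sumFin-++ m (k * m) f)
        (cong (sumFin m (λ j → f (j ↑ˡ (k * m))) ℚ.+_) (sumFin-combine k m (f ∘ (m ↑ʳ_))))

cost-cong : (G : WGraph n m) {H H′ : Subgraph m} → (∀ e → H e ≡ H′ e) → cost G H ≡ cost G H′
cost-cong {m = m} G H≗H′ = sumFin-cong m (λ e → cong (λ b → if b then weight G e else 0ℚ) (H≗H′ e))

LowerBound : StepRel n → Fin n → Fin n → ℚ → Set
LowerBound S u t d = (d′ : ℚ) → Walk S u t d′ → d ℚ.≤ d′

Shortens : StepRel n → Fin n → Fin n → StepRel n′ → Fin n′ → Fin n′ → Set
Shortens S u t S′ u′ t′ = ∀ {d} → Walk S u t d → Σ ℚ λ d′ → Walk S′ u′ t′ d′ × d′ ℚ.≤ d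

shortens-⊆ : {S S′ : StepRel n} → (∀ {x y c} → S x y c → S′ x y c) → ∀ {u t} → Shortens S u t S′ u t
shortens-⊆ {S = S} {S′} S⊆S′ W = _ , walk-⊆ W , ℚₚ.≤-refl
  where
    walk-⊆ : ∀ {x y d} → Walk S x y d → Walk S′ x y d
    walk-⊆ here         = here
    walk-⊆ (step st W′) = step (S⊆S′ st) (walk-⊆ W′)

undStep-⊆-full : (G : WGraph n m) {H : Subgraph m} → ∀ {x y c} → undStep G H x y c → undStep G full x y c
undStep-⊆-full G (e , _ , ends , wt) = e , refl , ends , wt

dirStep-⊆-full : (G : WGraph n m) {H : Subgraph m} → ∀ {x y c} → dirStep G H x y c → dirStep G full x y c
dirStep-⊆-full G (e , _ , ends , wt) = e , refl , ends , wt

lowerBound-transfer : {S : StepRel n₁} {S′ : StepRel n₂} {u t : Fin n₁} {u′ t′ : Fin n₂} {d : ℚ} →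
                      Shortens S u t S′ u′ t′ → LowerBound S′ u′ t′ d → LowerBound S u t d
lowerBound-transfer shorten lb d″ W with shorten W
... | d′ , W′ , d′≤d″ = ℚₚ.≤-trans (lb d′ W′) d′≤d″

isDist-transfer : {S₁ : StepRel n₁} {S₂ : StepRel n₂} {S₃ : StepRel n₃}
                  {u₁ t₁ : Fin n₁} {u₂ t₂ : Fin n₂} {u₃ t₃ : Fin n₃} {d : ℚ} →
                  Shortens S₁ u₁ t₁ S₂ u₂ t₂ → Shortens S₂ u₂ t₂ S₃ u₃ t₃ →
                  Walk S₁ u₁ t₁ d → LowerBound S₃ u₃ t₃ d → IsDist S₂ u₂ t₂ d
isDist-transfer {S₂ = S₂} {u₂ = u₂} {t₂} {d = d} shorten₁₂ shorten₂₃ W lb with shorten₁₂ W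
... | d′ , W′ , d′≤d = subst (Walk S₂ u₂ t₂) (ℚₚ.≤-antisym d′≤d (lb₂ d′ W′)) W′ , lb₂
  where
    lb₂ : LowerBound S₂ u₂ t₂ d
    lb₂ = lowerBound-transfer shorten₂₃ lb

mapPairs : (Fin n → Fin n′) → List (Fin n × Fin n) → List (Fin n′ × Fin n′)
mapPairs f = map (Product.map f f)

orientedAsGiven : (ι : Fin n → Fin n′) (P : List (Fin n × Fin n)) → Pointwise (OrientedAs ι) P (mapPairs ι P)
orientedAsGiven ι []      = []
orientedAsGiven ι (_ ∷ P) = inj₁ refl ∷ orientedAsGiven ι P

totalDist-map : {S : StepRel n} {S′ : StepRel n′} (f : Fin n → Fin n′) →
                (∀ {u t d} → IsDist S u t d → IsDist S′ (f u) (f t) d) →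
                ∀ P {U} → TotalDist S P U → TotalDist S′ (mapPairs f P) U
totalDist-map f dist []            U≡0 = U≡0
totalDist-map f dist ((u , t) ∷ P) (d , U′ , D , T , U≡) = d , U′ , dist D , totalDist-map f dist P T , U≡

totalDist-unmap : {S : StepRel n} {S′ : StepRel n′} (f : Fin n → Fin n′) →
                  (∀ {u t d} → IsDist S′ (f u) (f t) d → IsDist S u t d) →
                  ∀ P {U} → TotalDist S′ (mapPairs f P) U → TotalDist S P U
totalDist-unmap f dist []            U≡0 = U≡0
totalDist-unmap f dist ((u , t) ∷ P) (d , U′ , D , T , U≡) = d , U′ , dist D , totalDist-unmap f dist P T , U≡

PreservesPair : Reading n m → Subgraph m → Fin n → Fin n → Set
PreservesPair st H u t = (d : ℚ) → IsDist (st full) u t d → IsDist (st H) u t d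

preserver-map : {st : Reading n m} {st′ : Reading n′ m′} {H : Subgraph m} {H′ : Subgraph m′}
                (f : Fin n → Fin n′) →
                (∀ {u t} → PreservesPair st H u t → PreservesPair st′ H′ (f u) (f t)) →
                ∀ {P} → Preserver st P H → Preserver st′ (mapPairs f P) H′
preserver-map f preserves = map⁺ ∘ All.map preserves

preserver-unmap : {st : Reading n m} {st′ : Reading n′ m′} {H : Subgraph m} {H′ : Subgraph m′}
                  (f : Fin n → Fin n′) →
                  (∀ {u t} → PreservesPair st′ H′ (f u) (f t) → PreservesPair st H u t) →
                  ∀ {P} → Preserver st′ (mapPairs f P) H′ → Preserver st P H
preserver-unmap f preserves = All.map preserves ∘ map⁻

objVal-transfer : {G₁ : WGraph n₁ m} {G₂ : WGraph n₂ m′}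
                  {st₁ : Reading n₁ m} {st₂ : Reading n₂ m′}
                  {P₁ : List (Fin n₁ × Fin n₁)} {P₂ : List (Fin n₂ × Fin n₂)}
                  (lift : Subgraph m → Subgraph m′) (proj : Subgraph m′ → Subgraph m) →
                  (∀ {U} → TotalDist (st₁ full) P₁ U → TotalDist (st₂ full) P₂ U) →
                  (∀ H → Preserver st₁ P₁ H → Preserver st₂ P₂ (lift H)) →
                  (∀ H → cost G₂ (lift H) ≡ cost G₁ H) →
                  (∀ H′ → Preserver st₂ P₂ H′ → Preserver st₁ P₁ (proj H′)) →
                  (∀ H′ → cost G₁ (proj H′) ≡ cost G₂ H′) →
                  ∀ {v} → ObjVal G₁ st₁ P₁ v → ObjVal G₂ st₂ P₂ v
objVal-transfer lift proj total lift-pres lift-cost proj-pres proj-cost {v}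
                (U , T , (H , pres , U-cH≡v) , optimal) =
  U , total T , (lift H , lift-pres H pres , trans (cong (λ x → U ℚ.- x) (lift-cost H)) U-cH≡v) ,
  λ H′ pres′ → subst (ℚ._≤ v) (cong (λ x → U ℚ.- x) (proj-cost H′)) (optimal (proj H′) (proj-pres H′ pres′))

module Gadget (G : WGraph n m) (nonneg : NonNegWeights G)
              (loopless : (e : Fin m) → proj₁ (endpoints G e) ≢ proj₂ (endpoints G e)) where

  N M : ℕ
  N = n + 2 * m
  M = 5 * m

  data End : Set where
    first second : End

  end : End → Fin m → Fin n
  end first  e = proj₁ (endpoints G e)
  end second e = proj₂ (endpoints G e)

  opposite : End → End
  opposite first  = second
  opposite second = first

  end-injective : ∀ {s s′ e} → end s e ≡ end s′ e → s ≡ s′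
  end-injective {first}  {first}  _  = refl
  end-injective {first}  {second} eq = ⊥-elim (loopless _ eq)
  end-injective {second} {first}  eq = ⊥-elim (loopless _ (sym eq))
  end-injective {second} {second} _  = refl

  orientation : ∀ {e u v} → endpoints G e ≡ (u , v) ⊎ endpoints G e ≡ (v , u) →
                Σ End λ s → u ≡ end s e × v ≡ end (opposite s) e
  orientation (inj₁ refl) = first  , refl , refl
  orientation (inj₂ refl) = second , refl , refl

  d≤c+d : ∀ e d → d ℚ.≤ weight G e ℚ.+ d
  d≤c+d e d = subst (ℚ._≤ weight G e ℚ.+ d) (ℚₚ.+-identityˡ d) (ℚₚ.+-monoˡ-≤ d (nonneg e))

  via-edge : ∀ {H e t d} → H e ≡ true → ∀ s s′ → Walk (undStep G H) (end s′ e) t d →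
             Σ ℚ λ d′ → Walk (undStep G H) (end s e) t d′ × d′ ℚ.≤ weight G e ℚ.+ d
  via-edge {e = e} _ first  first  W = _ , W , d≤c+d e _
  via-edge         h first  second W = _ , step (_ , h , inj₁ refl , refl) W , ℚₚ.≤-refl
  via-edge         h second first  W = _ , step (_ , h , inj₂ refl , refl) W , ℚₚ.≤-refl
  via-edge {e = e} _ second second W = _ , W , d≤c+d e _

  data Vertex : Set where
    orig  : Fin n → Vertex
    entry : Fin m → Vertex
    exit  : Fin m → Vertex

  orig-injective : ∀ {u v} → orig u ≡ orig v → u ≡ v
  orig-injective refl = refl

  toFin : Vertex → Fin N
  toFin (orig u)  = u ↑ˡ (2 * m)
  toFin (entry e) = n ↑ʳ combine {2} 0F e
  toFin (exit e)  = n ↑ʳ combine {2} 1F e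

  gadgetVertex : Fin 2 × Fin m → Vertex
  gadgetVertex (0F , e) = entry e
  gadgetVertex (1F , e) = exit e

  fromFin : Fin N → Vertex
  fromFin i = [ orig , gadgetVertex ∘ remQuot m ]′ (splitAt n i)

  fromFin-gadget : ∀ (i : Fin 2) e → fromFin (n ↑ʳ combine i e) ≡ gadgetVertex (i , e)
  fromFin-gadget i e = trans (cong [ orig , gadgetVertex ∘ remQuot m ]′ (splitAt-↑ʳ n (2 * m) (combine i e)))
                             (cong gadgetVertex (remQuot-combine i e))

  fromFin-toFin : ∀ v → fromFin (toFin v) ≡ v
  fromFin-toFin (orig u)  = cong [ orig , gadgetVertex ∘ remQuot m ]′ (splitAt-↑ˡ n u (2 * m))
  fromFin-toFin (entry e) = fromFin-gadget 0F e
  fromFin-toFin (exit e)  = fromFin-gadget 1F e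

  toFin-injective : ∀ {v v′} → toFin v ≡ toFin v′ → v ≡ v′
  toFin-injective {v} {v′} eq = trans (sym (fromFin-toFin v)) (trans (cong fromFin eq) (fromFin-toFin v′))

  ι : Fin n → Fin N
  ι u = toFin (orig u)

  ι-injective : Injective _≡_ _≡_ ι
  ι-injective = orig-injective ∘ toFin-injective

  data Arc : Set where
    enter : End → Fin m → Arc
    cross : Fin m → Arc
    leave : End → Fin m → Arc

  src tgt : Arc → Vertex
  src (enter s e) = orig (end s e)
  src (cross e)   = entry e
  src (leave s e) = exit e
  tgt (enter s e) = entry e
  tgt (cross e)   = exit e
  tgt (leave s e) = orig (end s e)

  arcWeight : Arc → ℚ
  arcWeight (enter _ _) = 0ℚ
  arcWeight (cross e)   = weight G e
  arcWeight (leave _ _) = 0ℚ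

  edgeOf : Arc → Fin m
  edgeOf (enter _ e) = e
  edgeOf (cross e)   = e
  edgeOf (leave _ e) = e

  arcCode : Arc → Fin 5 × Fin m
  arcCode (enter first e)  = 0F , e
  arcCode (enter second e) = 1F , e
  arcCode (cross e)        = 2F , e
  arcCode (leave first e)  = 3F , e
  arcCode (leave second e) = 4F , e

  arcOf : Fin 5 × Fin m → Arc
  arcOf (0F , e) = enter first e
  arcOf (1F , e) = enter second e
  arcOf (2F , e) = cross e
  arcOf (3F , e) = leave first e
  arcOf (4F , e) = leave second e

  arcOf-arcCode : ∀ a → arcOf (arcCode a) ≡ a
  arcOf-arcCode (enter first _)  = refl
  arcOf-arcCode (enter second _) = refl
  arcOf-arcCode (cross _)        = refl
  arcOf-arcCode (leave first _)  = refl
  arcOf-arcCode (leave second _) = refl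

  arcCode-arcOf : ∀ p → arcCode (arcOf p) ≡ p
  arcCode-arcOf (0F , _) = refl
  arcCode-arcOf (1F , _) = refl
  arcCode-arcOf (2F , _) = refl
  arcCode-arcOf (3F , _) = refl
  arcCode-arcOf (4F , _) = refl

  arcIndex : Arc → Fin M
  arcIndex = uncurry combine ∘ arcCode

  arcAt : Fin M → Arc
  arcAt = arcOf ∘ remQuot m

  arcAt-combine : ∀ i e → arcAt (combine i e) ≡ arcOf (i , e)
  arcAt-combine i e = cong arcOf (remQuot-combine i e)

  arcAt-arcIndex : ∀ a → arcAt (arcIndex a) ≡ a
  arcAt-arcIndex a = trans (arcAt-combine _ _) (arcOf-arcCode a)

  arcIndex-arcAt : ∀ f → arcIndex (arcAt f) ≡ f
  arcIndex-arcAt f = trans (cong (uncurry combine) (arcCode-arcOf (remQuot m f))) (combine-remQuot {5} m f)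

  -- An arc is determined by its two endpoints (using that G has no loops).
  arc-determined : ∀ a b → src a ≡ src b → tgt a ≡ tgt b → a ≡ b
  arc-determined (enter s e) (enter s′ .e) srcs refl = cong (λ s → enter s e) (end-injective (orig-injective srcs))
  arc-determined (cross e)   (cross .e)    _    refl = refl
  arc-determined (leave s e) (leave s′ .e) refl tgts = cong (λ s → leave s e) (end-injective (orig-injective tgts))
  arc-determined (enter _ _) (cross _)   ()   _
  arc-determined (enter _ _) (leave _ _) ()   _
  arc-determined (cross _)   (enter _ _) ()   _
  arc-determined (cross _)   (leave _ _) ()   _
  arc-determined (leave _ _) (enter _ _) ()   _
  arc-determined (leave _ _) (cross _)   ()   _

  arc-noLoop : ∀ a → src a ≢ tgt a
  arc-noLoop (enter _ _) ()
  arc-noLoop (cross _)   ()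
  arc-noLoop (leave _ _) ()

  R : WGraph N M
  R = record { endpoints = λ f → toFin (src (arcAt f)) , toFin (tgt (arcAt f))
             ; weight    = λ f → arcWeight (arcAt f) }

  R-simple : DirSimple R
  R-simple = (λ f loop → arc-noLoop (arcAt f) (toFin-injective loop))
           , λ f f′ ends → trans (sym (arcIndex-arcAt f))
                             (trans (cong arcIndex (arc-determined (arcAt f) (arcAt f′)
                                                      (toFin-injective (cong proj₁ ends))
                                                      (toFin-injective (cong proj₂ ends))))
                                    (arcIndex-arcAt f′))

  R-nonneg : NonNegWeights R
  R-nonneg f = arcWeight-nonneg (arcAt f)
    where
      arcWeight-nonneg : ∀ a → 0ℚ ℚ.≤ arcWeight a
      arcWeight-nonneg (enter _ _) = ℚₚ.≤-refl
      arcWeight-nonneg (cross e)   = nonneg e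
      arcWeight-nonneg (leave _ _) = ℚₚ.≤-refl

  arcStep : ∀ {H′ : Subgraph M} a → H′ (arcIndex a) ≡ true → dirStep R H′ (toFin (src a)) (toFin (tgt a)) (arcWeight a)
  arcStep a kept = arcIndex a , kept , cong (λ b → toFin (src b) , toFin (tgt b)) (arcAt-arcIndex a)
                 , cong arcWeight (arcAt-arcIndex a)

  stepFrom : ∀ {H′ : Subgraph M} {v y c} → dirStep R H′ (toFin v) y c →
             Σ Arc λ a → H′ (arcIndex a) ≡ true × src a ≡ v × y ≡ toFin (tgt a) × c ≡ arcWeight a
  stepFrom {H′} (f , kept , ends , wt) =
    arcAt f , subst (λ i → H′ i ≡ true) (sym (arcIndex-arcAt f)) kept
            , toFin-injective (cong proj₁ ends) , sym (cong proj₂ ends) , sym wt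

  liftSub : Subgraph m → Subgraph M
  liftSub H f = H (edgeOf (arcAt f))

  projSub : Subgraph M → Subgraph m
  projSub H′ e = H′ (arcIndex (cross e))

  -- Only the middle arcs carry weight, so the cost of H′ is that of its projection.
  cost-projSub : ∀ H′ → cost G (projSub H′) ≡ cost R H′
  cost-projSub H′ = sym (begin
    cost R H′
      ≡⟨ sumFin-combine 5 m _ ⟩
    sumFin 5 (λ i → sumFin m (λ e → if H′ (combine i e) then arcWeight (arcAt (combine i e)) else 0ℚ))
      ≡⟨ sumFin-cong 5 (λ i → sumFin-cong m (λ e → cong (keptWeight i e) (arcAt-combine i e))) ⟩
    sumFin 5 block
      ≡⟨ cong₂ ℚ._+_ (silent 0F λ _ → refl) (cong₂ ℚ._+_ (silent 1F λ _ → refl) (cong (c ℚ.+_)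
           (cong₂ ℚ._+_ (silent 3F λ _ → refl) (cong₂ ℚ._+_ (silent 4F λ _ → refl) refl)))) ⟩
    0ℚ ℚ.+ (0ℚ ℚ.+ (c ℚ.+ (0ℚ ℚ.+ (0ℚ ℚ.+ 0ℚ))))
      ≡⟨ trans (ℚₚ.+-identityˡ _) (ℚₚ.+-identityˡ _) ⟩
    c ℚ.+ (0ℚ ℚ.+ (0ℚ ℚ.+ 0ℚ))
      ≡⟨ cong (c ℚ.+_) (trans (ℚₚ.+-identityˡ _) (ℚₚ.+-identityˡ 0ℚ)) ⟩
    c ℚ.+ 0ℚ
      ≡⟨ ℚₚ.+-identityʳ c ⟩
    c ∎)
    where
      open ≡-Reasoning
      c : ℚ
      c = cost G (projSub H′)

      keptWeight : Fin 5 → Fin m → Arc → ℚ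
      keptWeight i e a = if H′ (combine i e) then arcWeight a else 0ℚ

      block : Fin 5 → ℚ
      block i = sumFin m (λ e → keptWeight i e (arcOf (i , e)))

      silent : ∀ i → (∀ e → arcWeight (arcOf (i , e)) ≡ 0ℚ) → block i ≡ 0ℚ
      silent i weightless = sumFin-zero m (λ e → unkept-or-zero (H′ (combine i e)) (weightless e))
        where
          unkept-or-zero : ∀ b {x} → x ≡ 0ℚ → (if b then x else 0ℚ) ≡ 0ℚ
          unkept-or-zero true  x≡0 = x≡0
          unkept-or-zero false _   = refl

  cost-liftSub : ∀ H → cost R (liftSub H) ≡ cost G H
  cost-liftSub H = trans (sym (cost-projSub (liftSub H)))
                         (cost-cong G (λ e → cong (H ∘ edgeOf) (arcAt-arcIndex (cross e))))

  absorb-0 : ∀ {x d} → x ℚ.≤ d → x ℚ.≤ 0ℚ ℚ.+ d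
  absorb-0 {x} {d} = subst (x ℚ.≤_) (sym (ℚₚ.+-identityˡ d))

  -- Walks of G in H become walks of R in the lifted subgraph, of the same length:
  -- a step along e is replaced by the three arcs through the gadget of e.
  module Lift (H : Subgraph m) where

    kept : ∀ a → H (edgeOf a) ≡ true → liftSub H (arcIndex a) ≡ true
    kept a = subst (λ b → H (edgeOf b) ≡ true) (sym (arcAt-arcIndex a))

    throughGadget : ∀ {e y d} → H e ≡ true → ∀ s s′ →
                    Walk (dirStep R (liftSub H)) (ι (end s′ e)) y d →
                    Walk (dirStep R (liftSub H)) (ι (end s e)) y (weight G e ℚ.+ d)
    throughGadget {e} {y} {d} h s s′ W =
      subst (Walk (dirStep R (liftSub H)) (ι (end s e)) y) gadget-length
        (step (arcStep (enter s e) (kept (enter s e) h))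
        (step (arcStep (cross e) (kept (cross e) h))
        (step (arcStep (leave s′ e) (kept (leave s′ e) h)) W)))
      where
        gadget-length : 0ℚ ℚ.+ (weight G e ℚ.+ (0ℚ ℚ.+ d)) ≡ weight G e ℚ.+ d
        gadget-length = trans (ℚₚ.+-identityˡ _) (cong (weight G e ℚ.+_) (ℚₚ.+-identityˡ d))

    liftWalk : ∀ {u v d} → Walk (undStep G H) u v d → Walk (dirStep R (liftSub H)) (ι u) (ι v) d
    liftWalk here = here
    liftWalk (step (e , h , ends , refl) W) with orientation ends
    ... | s , refl , refl = throughGadget h s (opposite s) (liftWalk W)

    embed : ∀ {u t} → Shortens (undStep G H) u t (dirStep R (liftSub H)) (ι u) (ι t)
    embed W = _ , liftWalk W , ℚₚ.≤-refl

  -- The walk is read off gadget by gadget: from an original vertex it must enter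
  -- some gadget, cross it along the (kept) middle arc and leave at one of the two ends.
  module Shortcut (H′ : Subgraph M) where

    S′ : StepRel N
    S′ = dirStep R H′

    S : StepRel n
    S = undStep G (projSub H′)

    mutual
      fromOrig : ∀ {x y d u t} → Walk S′ x y d → x ≡ ι u → y ≡ ι t →
                 Σ ℚ λ d′ → Walk S u t d′ × d′ ℚ.≤ d
      fromOrig here refl y≡ with ι-injective y≡
      ... | refl = 0ℚ , here , ℚₚ.≤-refl
      fromOrig (step st W) refl y≡ with stepFrom {v = orig _} st
      ... | enter s e , _ , refl , mid , refl with fromEntry W mid y≡
      ...   | s′ , d′ , e∈ , W′ , d′≤ with via-edge e∈ s s′ W′
      ...     | d″ , W″ , d″≤ = d″ , W″ , absorb-0 (ℚₚ.≤-trans d″≤ d′≤)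
      fromOrig (step st W) refl y≡ | cross _   , _ , () , _ , _
      fromOrig (step st W) refl y≡ | leave _ _ , _ , () , _ , _

      fromEntry : ∀ {x y d e t} → Walk S′ x y d → x ≡ toFin (entry e) → y ≡ ι t →
                  Σ End λ s → Σ ℚ λ d′ → projSub H′ e ≡ true × Walk S (end s e) t d′ ×
                                         weight G e ℚ.+ d′ ℚ.≤ d
      fromEntry here refl y≡ with toFin-injective {entry _} {orig _} y≡
      ... | ()
      fromEntry (step st W) refl y≡ with stepFrom {v = entry _} st
      ... | cross e , e∈ , refl , mid , refl with fromExit W mid y≡
      ...   | s , d′ , W′ , d′≤ = s , d′ , e∈ , W′ , ℚₚ.+-monoʳ-≤ (weight G e) d′≤
      fromEntry (step st W) refl y≡ | enter _ _ , _ , () , _ , _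
      fromEntry (step st W) refl y≡ | leave _ _ , _ , () , _ , _

      fromExit : ∀ {x y d e t} → Walk S′ x y d → x ≡ toFin (exit e) → y ≡ ι t →
                 Σ End λ s → Σ ℚ λ d′ → Walk S (end s e) t d′ × d′ ℚ.≤ d
      fromExit here refl y≡ with toFin-injective {exit _} {orig _} y≡
      ... | ()
      fromExit (step st W) refl y≡ with stepFrom {v = exit _} st
      ... | leave s e , _ , refl , mid , refl with fromOrig W mid y≡
      ...   | d′ , W′ , d′≤ = s , d′ , W′ , absorb-0 d′≤
      fromExit (step st W) refl y≡ | enter _ _ , _ , () , _ , _
      fromExit (step st W) refl y≡ | cross _   , _ , () , _ , _

    shortcut : ∀ {u t} → Shortens S′ (ι u) (ι t) S u t
    shortcut W = fromOrig W refl refl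

  open Lift using (embed)
  open Shortcut using (shortcut)

  dist-to-R : ∀ {u t d} → IsDist (undStep G full) u t d → IsDist (dirStep R full) (ι u) (ι t) d
  dist-to-R (W , lb) = isDist-transfer (embed full) (shortcut full) W lb

  dist-from-R : ∀ {u t d} → IsDist (dirStep R full) (ι u) (ι t) d → IsDist (undStep G full) u t d
  dist-from-R (W , lb) = isDist-transfer (shortcut full) (embed full) W lb

  preserves-lift : ∀ {H u t} → PreservesPair (undStep G) H u t → PreservesPair (dirStep R) (liftSub H) (ι u) (ι t)
  preserves-lift {H} preserves d D =
    isDist-transfer (embed H) (shortens-⊆ (dirStep-⊆-full R)) (proj₁ (preserves d (dist-from-R D))) (proj₂ D)

  preserves-proj : ∀ {H′ u t} → PreservesPair (dirStep R) H′ (ι u) (ι t) → PreservesPair (undStep G) (projSub H′) u t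
  preserves-proj {H′} preserves d D =
    isDist-transfer (shortcut H′) (shortens-⊆ (undStep-⊆-full G)) (proj₁ (preserves d (dist-to-R D))) (proj₂ D)

  lift-preserver : ∀ {P} H → Preserver (undStep G) P H → Preserver (dirStep R) (mapPairs ι P) (liftSub H)
  lift-preserver H = preserver-map {st = undStep G} {st′ = dirStep R} ι (preserves-lift {H})

  proj-preserver : ∀ {P} H′ → Preserver (dirStep R) (mapPairs ι P) H′ → Preserver (undStep G) P (projSub H′)
  proj-preserver H′ = preserver-unmap {st = undStep G} {st′ = dirStep R} ι (preserves-proj {H′})

  objVal⇔ : ∀ P v → UndObjVal G P v ⇔ DirObjVal R (mapPairs ι P) v
  objVal⇔ P v = mk⇔
    (objVal-transfer {G₁ = G} {G₂ = R} liftSub projSub (totalDist-map ι dist-to-R P)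
       lift-preserver cost-liftSub proj-preserver cost-projSub)
    (objVal-transfer {G₁ = R} {G₂ = G} projSub liftSub (totalDist-unmap ι dist-from-R P)
       proj-preserver cost-projSub lift-preserver cost-liftSub)

lemma1 : ∀ {n m} (G : WGraph n m) → NonNegWeights G → UndSimple G →
    (P : List (Fin n × Fin n)) →
    Σ (WGraph (n + 2 * m) (5 * m)) λ R →
    DirSimple R × NonNegWeights R ×
    Σ (Fin n → Fin (n + 2 * m)) λ ι → Injective _≡_ _≡_ ι ×
    Σ (List (Fin (n + 2 * m) × Fin (n + 2 * m))) λ PR →
    Pointwise (OrientedAs ι) P PR ×
    ((v : ℚ) → UndObjVal G P v ⇔ DirObjVal R PR v)
lemma1 G nonneg (loopless , _) P =
  R , R-simple , R-nonneg , ι , ι-injective , mapPairs ι P , orientedAsGiven ι P , objVal⇔ P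
  where open Gadget G nonneg loopless
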